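{- Let $n$ be a positive integer and let $G$ and $A$ be fixed integers. For any fixed integer $x$, there is at most one integer $y\in[-G,G]$ such that $\gcd(xA+y,n)>\sqrt{2Gn}$. Furthermore, if $\gcd(A,n)=1$, then for any fixed integer $y$, there is at most one integer $x\in[-G,G]$ such that $\gcd(xA+y,n)>\sqrt{2Gn}$.
   Context: $\gcd(0,n)=n$. -}

module Defs where

open import Data.Integer using (ℤ; +_; _+_; _*_; _<_; _≤_; -_)
open import Data.Product using (_×_)
open import Data.Integer.GCD using (gcd)

-- "gcd(x A + y, n) > sqrt(2 G n)".
-- Since gcd(·,·) ≥ 0, and (when G ≥ 0, n > 0) sqrt(2Gn) ≥ 0, this is equivalent to
-- gcd(xA+y,n)^2 > 2 G n.  (For G < 0 the interval [-G,G] is empty, so the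
-- statement is vacuous under either reading.)
LargeGcd : (G A n x y : ℤ) → Set
LargeGcd G A n x y = + 2 * G * n < gcd (x * A + y) n * gcd (x * A + y) n

InRange : (G z : ℤ) → Set
InRange G z = (- G ≤ z) × (z ≤ G)

{-# OPTIONS --safe #-}
module Submission where

-- Both gcds divide n and exceed sqrt(2Gn), so their gcd g satisfies
-- g · n ≥ g · lcm = d₁ d₂ > 2Gn, i.e. g > 2G.  But g divides the difference of
-- the two values of xA + y, which is y₁ - y₂ (resp. (x₁ - x₂)A with g coprime
-- to A), of absolute value at most 2G; hence that difference is 0.

open import Defs
open import Data.Integer using (ℤ; _<_; 0ℤ; 1ℤ)
open import Data.Integer.GCD using (gcd)
open import Data.Product using (_×_)
open import Relation.Binary.PropositionalEquality using (_≡_)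

open import Data.Empty using (⊥; ⊥-elim)
open import Data.Integer using (_+_; _*_; +_; +[1+_]; -[1+_]; ∣_∣; _-_; +<+; +≤+; -≤-)
open import Data.Integer.Divisibility.Signed using (∣ᵤ⇒∣; ∣⇒∣ᵤ; ∣m∣n⇒∣m-n)
import Data.Integer.Properties as ℤ
open import Data.Integer.Tactic.RingSolver using (solve-∀)
open import Data.Nat as ℕ using (ℕ; zero; suc; NonZero)
open import Data.Nat.Coprimality using (Coprime; gcd≡1⇒coprime; coprime-divisor)
open import Data.Nat.Divisibility using (_∣_; ∣-trans; ∣⇒≤; >⇒∤)
open import Data.Nat.GCD as ℕ using (gcd[m,n]∣m; gcd[m,n]∣n)
open import Data.Nat.LCM using (lcm; lcm-least; gcd*lcm)
open import Data.Nat.Properties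
open import Data.Product using (_,_)
open import Data.Sum using (inj₁; inj₂)
open import Relation.Binary.PropositionalEquality using (refl; sym; trans; cong; subst)

<-squares⇒<-* : ∀ {c a b} → c ℕ.< a ℕ.* a → c ℕ.< b ℕ.* b → c ℕ.< a ℕ.* b
<-squares⇒<-* {a = a} {b} c<a² c<b² with ≤-total a b
... | inj₁ a≤b = <-≤-trans c<a² (*-monoʳ-≤ a a≤b)
... | inj₂ b≤a = <-≤-trans c<b² (*-monoˡ-≤ b b≤a)

∣∧<⇒≡0 : ∀ {m k} → m ∣ k → k ℕ.< m → k ≡ 0
∣∧<⇒≡0 {k = zero}  _   _   = refl
∣∧<⇒≡0 {k = suc _} m∣k k<m with () ← >⇒∤ k<m m∣k

large-divisors⇒large-gcd : ∀ {c n d₁ d₂} .{{_ : NonZero n}} → d₁ ∣ n → d₂ ∣ n →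
  c ℕ.* n ℕ.< d₁ ℕ.* d₁ → c ℕ.* n ℕ.< d₂ ℕ.* d₂ → c ℕ.< ℕ.gcd d₁ d₂
large-divisors⇒large-gcd {c} {n} {d₁} {d₂} d₁∣n d₂∣n cn<d₁² cn<d₂² =
  *-cancelʳ-< n c (ℕ.gcd d₁ d₂) (begin-strict
    c ℕ.* n                   <⟨ <-squares⇒<-* {a = d₁} cn<d₁² cn<d₂² ⟩
    d₁ ℕ.* d₂                 ≡⟨ gcd*lcm d₁ d₂ ⟨
    ℕ.gcd d₁ d₂ ℕ.* lcm d₁ d₂ ≤⟨ *-monoʳ-≤ (ℕ.gcd d₁ d₂) (∣⇒≤ (lcm-least d₁∣n d₂∣n)) ⟩
    ℕ.gcd d₁ d₂ ℕ.* n         ∎)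
  where open ≤-Reasoning

coprime-∣ : ∀ {m n d} → Coprime m n → d ∣ n → Coprime d m
coprime-∣ m⊥n d∣n (c∣d , c∣m) = m⊥n (c∣m , ∣-trans c∣d d∣n)

∣⇒∣∣-∣ : ∀ {m} i j → m ∣ ∣ i ∣ → m ∣ ∣ j ∣ → m ∣ ∣ i - j ∣
∣⇒∣∣-∣ {m} i j m∣i m∣j =
  ∣⇒∣ᵤ {+ m} {i - j} (∣m∣n⇒∣m-n {+ m} {i} {j} (∣ᵤ⇒∣ {+ m} {i} m∣i) (∣ᵤ⇒∣ {+ m} {j} m∣j))

InRange-empty : ∀ {g i} → InRange -[1+ g ] i → ⊥
InRange-empty (-g≤i , i≤-g) with () ← ℤ.≤-trans -g≤i i≤-g

InRange⇒∣∣≤ : ∀ {G i} → InRange (+ G) i → ∣ i ∣ ℕ.≤ G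
InRange⇒∣∣≤ {G}     {+ _}      (_ , +≤+ i≤G) = i≤G
InRange⇒∣∣≤ {suc _} { -[1+ _ ] } (-≤- i≤G , _) = ℕ.s≤s i≤G

InRange⇒∣-∣≤ : ∀ {G i j} → InRange (+ G) i → InRange (+ G) j → ∣ i - j ∣ ℕ.≤ 2 ℕ.* G
InRange⇒∣-∣≤ {G} {i} {j} i∈ j∈ = begin
  ∣ i - j ∣           ≤⟨ ℤ.∣i-j∣≤∣i∣+∣j∣ i j ⟩
  ∣ i ∣ ℕ.+ ∣ j ∣     ≤⟨ +-mono-≤ (InRange⇒∣∣≤ i∈) (InRange⇒∣∣≤ j∈) ⟩
  G ℕ.+ G             ≡⟨ cong (G ℕ.+_) (+-identityʳ G) ⟨
  2 ℕ.* G             ∎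
  where open ≤-Reasoning

+-*-<⇒*-< : ∀ G n d → + 2 * + G * + n < + d * + d → 2 ℕ.* G ℕ.* n ℕ.< d ℕ.* d
+-*-<⇒*-< G n d 2Gn<d² rewrite sym (ℤ.pos-* 2 G) | sym (ℤ.pos-* (2 ℕ.* G) n) | sym (ℤ.pos-* d d)
  = ℤ.drop‿+<+ 2Gn<d²

agree-if-large-gcds : ∀ {n G} .{{_ : NonZero n}} (u v : ℤ) {i j : ℤ} →
  InRange (+ G) i → InRange (+ G) j →
  (∀ {g} → g ∣ n → g ∣ ∣ u - v ∣ → g ∣ ∣ i - j ∣) →
  + 2 * + G * + n < gcd u (+ n) * gcd u (+ n) →
  + 2 * + G * + n < gcd v (+ n) * gcd v (+ n) →
  i ≡ j
agree-if-large-gcds {n} {G} u v {i} {j} i∈ j∈ transfer large-u large-v =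
  ℤ.i-j≡0⇒i≡j i j (ℤ.∣i∣≡0⇒i≡0 (∣∧<⇒≡0 g∣i-j (≤-<-trans (InRange⇒∣-∣≤ i∈ j∈) 2G<g)))
  where
  dᵤ dᵥ g : ℕ
  dᵤ = ℕ.gcd (∣ u ∣) n
  dᵥ = ℕ.gcd (∣ v ∣) n
  g  = ℕ.gcd dᵤ dᵥ
  g∣n : g ∣ n
  g∣n = ∣-trans (gcd[m,n]∣m dᵤ dᵥ) (gcd[m,n]∣n ∣ u ∣ n)
  g∣u-v : g ∣ ∣ u - v ∣
  g∣u-v = ∣⇒∣∣-∣ u v (∣-trans (gcd[m,n]∣m dᵤ dᵥ) (gcd[m,n]∣m ∣ u ∣ n))
                     (∣-trans (gcd[m,n]∣n dᵤ dᵥ) (gcd[m,n]∣m ∣ v ∣ n))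
  g∣i-j : g ∣ ∣ i - j ∣
  g∣i-j = transfer g∣n g∣u-v
  2G<g : 2 ℕ.* G ℕ.< g
  2G<g = large-divisors⇒large-gcd (gcd[m,n]∣n ∣ u ∣ n) (gcd[m,n]∣n ∣ v ∣ n)
    (+-*-<⇒*-< G n dᵤ large-u) (+-*-<⇒*-< G n dᵥ large-v)

[i*j+k]-[i*j+l]≡k-l : ∀ i j k l → (i * j + k) - (i * j + l) ≡ k - l
[i*j+k]-[i*j+l]≡k-l = solve-∀

[i*k+l]-[j*k+l]≡k*[i-j] : ∀ i j k l → (i * k + l) - (j * k + l) ≡ k * (i - j)
[i*k+l]-[j*k+l]≡k*[i-j] = solve-∀

lemma2 : (n G A : ℤ) → 0ℤ < n →
    ((x y₁ y₂ : ℤ) → InRange G y₁ → InRange G y₂ →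
      LargeGcd G A n x y₁ → LargeGcd G A n x y₂ → y₁ ≡ y₂)
    × (gcd A n ≡ 1ℤ →
      (y x₁ x₂ : ℤ) → InRange G x₁ → InRange G x₂ →
      LargeGcd G A n x₁ y → LargeGcd G A n x₂ y → x₁ ≡ x₂)
lemma2 (+ zero) _ _ (+<+ ())
lemma2 +[1+ _ ] -[1+ _ ] _ _ =
  (λ _ _ _ y₁∈ → ⊥-elim (InRange-empty y₁∈)) , (λ _ _ _ _ x₁∈ → ⊥-elim (InRange-empty x₁∈))
lemma2 +[1+ n ] (+ G) A _ = unique-y , unique-x
  where
  unique-y : (x y₁ y₂ : ℤ) → InRange (+ G) y₁ → InRange (+ G) y₂ →
    LargeGcd (+ G) A +[1+ n ] x y₁ → LargeGcd (+ G) A +[1+ n ] x y₂ → y₁ ≡ y₂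
  unique-y x y₁ y₂ y₁∈ y₂∈ large₁ large₂ =
    agree-if-large-gcds (x * A + y₁) (x * A + y₂) y₁∈ y₂∈
      (λ {g} _ → subst (g ∣_) (cong ∣_∣ ([i*j+k]-[i*j+l]≡k-l x A y₁ y₂)))
      large₁ large₂
  unique-x : gcd A +[1+ n ] ≡ 1ℤ → (y x₁ x₂ : ℤ) → InRange (+ G) x₁ → InRange (+ G) x₂ →
    LargeGcd (+ G) A +[1+ n ] x₁ y → LargeGcd (+ G) A +[1+ n ] x₂ y → x₁ ≡ x₂
  unique-x gcd≡1 y x₁ x₂ x₁∈ x₂∈ large₁ large₂ =
    agree-if-large-gcds (x₁ * A + y) (x₂ * A + y) x₁∈ x₂∈
      (λ {g} g∣n g∣u-v → coprime-divisor (coprime-∣ A⊥n g∣n)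
        (subst (g ∣_) (trans (cong ∣_∣ ([i*k+l]-[j*k+l]≡k*[i-j] x₁ x₂ A y))
                             (ℤ.abs-* A (x₁ - x₂))) g∣u-v))
      large₁ large₂
    where
    A⊥n : Coprime ∣ A ∣ (suc n)
    A⊥n = gcd≡1⇒coprime (ℤ.+-injective gcd≡1)
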